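{- Let $n\ge 2$ and for $1\le i\le n-1$ let $f_i\in S_n$ be the prefix reversal defined by $f_i(m)=i+2-m$ for $1\le m\le i+1$ and $f_i(m)=m$ for $i+1<m\le n$. For all $i,j,k$ with $1\le i,j,k\le n-1$ and every rearrangement $(a,b,c)$ of the triple $(i,j,k)$ (i.e. $(a,b,c)=(\sigma(i),\sigma(j),\sigma(k))$ for a permutation $\sigma$ of the multiset $\{i,j,k\}$), the order of $f_af_bf_c$ in $S_n$ equals the order of $f_if_jf_k$.
   Context: $S_n$ is the symmetric group on $\{1,\dots,n\}$, with permutations composed as functions. -}

module Defs where

open import Data.Nat using (ℕ; zero; suc; _≤_; _<_; _≤?_; _∸_)
open import Data.Nat.Properties using (m∸n≤m; ≤-<-trans)
open import Data.Fin using (Fin; toℕ; fromℕ<)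
open import Data.Product using (_×_; _,_)
open import Relation.Nullary using (yes; no; ¬_)
open import Relation.Binary.PropositionalEquality using (_≡_)
open import Function using (_∘_; id)

-- Points 1..n of S_n are represented by Fin n, point m ↦ index m-1.
-- Prefix reversal f_i (1 ≤ i ≤ n-1): f_i(m) = i+2-m for m ≤ i+1, f_i(m) = m otherwise.
-- In 0-based indices x = m-1 this reads: x ↦ i - x for x ≤ i, x ↦ x otherwise.
prefixRev : (n i : ℕ) → i < n → Fin n → Fin n
prefixRev n i i<n x with toℕ x ≤? i
... | yes _ = fromℕ< (≤-<-trans (m∸n≤m i (toℕ x)) i<n)
... | no _ = x

_^_ : {n : ℕ} → (Fin n → Fin n) → ℕ → (Fin n → Fin n)
g ^ zero = id
g ^ suc k = g ∘ (g ^ k)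

IsOrder : {n : ℕ} → (Fin n → Fin n) → ℕ → Set
IsOrder g k = (1 ≤ k) × (∀ x → (g ^ k) x ≡ x)
              × (∀ m → 1 ≤ m → m < k → ¬ (∀ x → (g ^ m) x ≡ x))

data Rearrangement {A : Set} : A → A → A → A → A → A → Set where
  ijk : ∀ {i j k} → Rearrangement i j k i j k
  ikj : ∀ {i j k} → Rearrangement i j k i k j
  jik : ∀ {i j k} → Rearrangement i j k j i k
  jki : ∀ {i j k} → Rearrangement i j k j k i
  kij : ∀ {i j k} → Rearrangement i j k k i j
  kji : ∀ {i j k} → Rearrangement i j k k j i

-- The order of g ∈ Sₙ depends only on which exponents m satisfy g ^ m = id, and that set is
-- unchanged by conjugation and by inversion. For involutions p, q, r the product q ∘ r ∘ p is
-- the conjugate of p ∘ q ∘ r by q ∘ r, and r ∘ q ∘ p is its inverse; rotations and the reversal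
-- generate all six rearrangements, and prefix reversals are involutions.
module Submission where

open import Defs
open import Data.Nat using (ℕ; zero; suc; _≤_; _<_; _∸_; _≤?_)
open import Data.Nat.Properties using (<-irrelevant; m∸[m∸n]≡n; m∸n≤m)
open import Data.Fin using (Fin; toℕ)
open import Data.Fin.Properties using (toℕ-injective; toℕ-fromℕ<)
open import Data.Product using (Σ; _,_)
open import Data.Empty using (⊥-elim)
open import Relation.Nullary using (Dec; yes; no; ¬_)
open import Relation.Binary.PropositionalEquality
open import Function using (_∘_; id)
open import Function.Bundles using (_⇔_; mk⇔; Equivalence)
open import Function.Construct.Identity using (⇔-id)
open import Function.Construct.Symmetry using (⇔-sym)
open import Function.Construct.Composition using (_⇔-∘_)

module _ {n i : ℕ} (i<n : i < n) where

  toℕ-prefixRev-≤ : ∀ x → toℕ x ≤ i → toℕ (prefixRev n i i<n x) ≡ i ∸ toℕ x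
  toℕ-prefixRev-≤ x x≤i with toℕ x ≤? i
  ... | yes _  = toℕ-fromℕ< _
  ... | no x≰i = ⊥-elim (x≰i x≤i)

  prefixRev-≰ : ∀ x → ¬ toℕ x ≤ i → prefixRev n i i<n x ≡ x
  prefixRev-≰ x x≰i with toℕ x ≤? i
  ... | yes x≤i = ⊥-elim (x≰i x≤i)
  ... | no _    = refl

  prefixRev-involutive : ∀ x → prefixRev n i i<n (prefixRev n i i<n x) ≡ x
  prefixRev-involutive x = involutive-by (toℕ x ≤? i)
    where
    open ≡-Reasoning
    f : Fin n → Fin n
    f = prefixRev n i i<n

    involutive-by : Dec (toℕ x ≤ i) → f (f x) ≡ x
    involutive-by (no x≰i) = trans (cong f (prefixRev-≰ x x≰i)) (prefixRev-≰ x x≰i)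
    involutive-by (yes x≤i) = toℕ-injective (begin
      toℕ (f (f x))   ≡⟨ toℕ-prefixRev-≤ (f x) fx≤i ⟩
      i ∸ toℕ (f x)   ≡⟨ cong (i ∸_) (toℕ-prefixRev-≤ x x≤i) ⟩
      i ∸ (i ∸ toℕ x) ≡⟨ m∸[m∸n]≡n x≤i ⟩
      toℕ x           ∎)
      where
      fx≤i : toℕ (f x) ≤ i
      fx≤i = subst (_≤ i) (sym (toℕ-prefixRev-≤ x x≤i)) (m∸n≤m i (toℕ x))

module _ {n : ℕ} where

  PowerIsId : (Fin n → Fin n) → ℕ → Set
  PowerIsId g m = g ^ m ≗ id

  SameIdentityPowers : (Fin n → Fin n) → (Fin n → Fin n) → Set
  SameIdentityPowers g h = ∀ m → PowerIsId g m ⇔ PowerIsId h m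

  SameIdentityPowers-sym : ∀ {g h : Fin n → Fin n} →
    SameIdentityPowers g h → SameIdentityPowers h g
  SameIdentityPowers-sym g∼h m = ⇔-sym (g∼h m)

  SameIdentityPowers-trans : ∀ {g h k : Fin n → Fin n} →
    SameIdentityPowers g h → SameIdentityPowers h k → SameIdentityPowers g k
  SameIdentityPowers-trans g∼h h∼k m = h∼k m ⇔-∘ g∼h m

  IsOrder-resp : ∀ {g h : Fin n → Fin n} →
    SameIdentityPowers g h → ∀ k → IsOrder g k → IsOrder h k
  IsOrder-resp g∼h k (1≤k , gᵏ≗id , minimal) =
    1≤k , Equivalence.to (g∼h k) gᵏ≗id ,
    λ m 1≤m m<k hᵐ≗id → minimal m 1≤m m<k (Equivalence.from (g∼h m) hᵐ≗id)

  IsOrder-cong : ∀ {g h : Fin n → Fin n} →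
    SameIdentityPowers g h → ∀ k → IsOrder g k ⇔ IsOrder h k
  IsOrder-cong g∼h k =
    mk⇔ (IsOrder-resp g∼h k) (IsOrder-resp (SameIdentityPowers-sym g∼h) k)

  ^-conjugate : ∀ {g h s : Fin n → Fin n} →
    h ∘ s ≗ s ∘ g → ∀ m → (h ^ m) ∘ s ≗ s ∘ (g ^ m)
  ^-conjugate hs≗sg zero    x = refl
  ^-conjugate {h = h} hs≗sg (suc m) x = trans (cong h (^-conjugate hs≗sg m x)) (hs≗sg _)

  conjugate⇒SameIdentityPowers : ∀ {g h s t : Fin n → Fin n} → h ∘ s ≗ s ∘ g →
    t ∘ s ≗ id → s ∘ t ≗ id → SameIdentityPowers g h
  conjugate⇒SameIdentityPowers {g} {h} {s} {t} hs≗sg ts≗id st≗id m =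
    mk⇔ (λ gᵐ≗id y → begin
          (h ^ m) y           ≡⟨ cong (h ^ m) (sym (st≗id y)) ⟩
          (h ^ m) (s (t y))   ≡⟨ ^-conjugate hs≗sg m (t y) ⟩
          s ((g ^ m) (t y))   ≡⟨ cong s (gᵐ≗id (t y)) ⟩
          s (t y)             ≡⟨ st≗id y ⟩
          y                   ∎)
        (λ hᵐ≗id x → begin
          (g ^ m) x           ≡⟨ sym (ts≗id _) ⟩
          t (s ((g ^ m) x))   ≡⟨ cong t (sym (^-conjugate hs≗sg m x)) ⟩
          t ((h ^ m) (s x))   ≡⟨ cong t (hᵐ≗id (s x)) ⟩
          t (s x)             ≡⟨ ts≗id x ⟩
          x                   ∎)
    where open ≡-Reasoning

  ^-suc-right : ∀ (g : Fin n → Fin n) m → g ^ suc m ≗ (g ^ m) ∘ g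
  ^-suc-right g zero    x = refl
  ^-suc-right g (suc m) x = cong g (^-suc-right g m x)

  ^-inverse : ∀ {g h : Fin n → Fin n} → h ∘ g ≗ id → ∀ m → (h ^ m) ∘ (g ^ m) ≗ id
  ^-inverse hg≗id zero    x = refl
  ^-inverse {h = h} hg≗id (suc m) x =
    trans (^-suc-right h m _) (trans (cong (h ^ m) (hg≗id _)) (^-inverse hg≗id m x))

  inverse⇒SameIdentityPowers : ∀ {g h : Fin n → Fin n} →
    h ∘ g ≗ id → g ∘ h ≗ id → SameIdentityPowers g h
  inverse⇒SameIdentityPowers {g} {h} hg≗id gh≗id m =
    mk⇔ (λ gᵐ≗id x → trans (cong (h ^ m) (sym (gᵐ≗id x))) (^-inverse hg≗id m x))
        (λ hᵐ≗id x → trans (cong (g ^ m) (sym (hᵐ≗id x))) (^-inverse gh≗id m x))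

  module _ (p q r : Fin n → Fin n)
           (p-inv : p ∘ p ≗ id) (q-inv : q ∘ q ≗ id) (r-inv : r ∘ r ≗ id) where

    rotate-SameIdentityPowers : SameIdentityPowers (p ∘ q ∘ r) (q ∘ r ∘ p)
    rotate-SameIdentityPowers =
      conjugate⇒SameIdentityPowers {p ∘ q ∘ r} {q ∘ r ∘ p} {q ∘ r} {r ∘ q}
      (λ _ → refl)
      (λ x → trans (cong r (q-inv _)) (r-inv x))
      (λ x → trans (cong q (r-inv _)) (q-inv x))

    reverse-SameIdentityPowers : SameIdentityPowers (p ∘ q ∘ r) (r ∘ q ∘ p)
    reverse-SameIdentityPowers = inverse⇒SameIdentityPowers {p ∘ q ∘ r} {r ∘ q ∘ p}
      (λ x → trans (cong (r ∘ q) (p-inv _)) (trans (cong r (q-inv _)) (r-inv x)))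
      (λ x → trans (cong (p ∘ q) (r-inv _)) (trans (cong p (q-inv _)) (p-inv x)))

  module _ {A : Set} (F : A → Fin n → Fin n) (F-inv : ∀ a → F a ∘ F a ≗ id) where

    private
      rot : ∀ x y z → SameIdentityPowers (F x ∘ F y ∘ F z) (F y ∘ F z ∘ F x)
      rot x y z = rotate-SameIdentityPowers (F x) (F y) (F z) (F-inv x) (F-inv y) (F-inv z)

      rev : ∀ x y z → SameIdentityPowers (F x ∘ F y ∘ F z) (F z ∘ F y ∘ F x)
      rev x y z = reverse-SameIdentityPowers (F x) (F y) (F z) (F-inv x) (F-inv y) (F-inv z)

    rearrangement-SameIdentityPowers : ∀ {i j k a b c} → Rearrangement i j k a b c →
      SameIdentityPowers (F a ∘ F b ∘ F c) (F i ∘ F j ∘ F k)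
    rearrangement-SameIdentityPowers ijk = λ m → ⇔-id _
    rearrangement-SameIdentityPowers {i} {j} {k} ikj =
      SameIdentityPowers-trans (rot i k j) (rev k j i)
    rearrangement-SameIdentityPowers {i} {j} {k} jik =
      SameIdentityPowers-trans (rev j i k) (rot k i j)
    rearrangement-SameIdentityPowers {i} {j} {k} jki = SameIdentityPowers-sym (rot i j k)
    rearrangement-SameIdentityPowers {i} {j} {k} kij = rot k i j
    rearrangement-SameIdentityPowers {i} {j} {k} kji = rev k j i

Rearrangement-with-proofs : {A : Set} {P : A → Set} → (∀ {x} (u v : P x) → u ≡ v) →
  ∀ {i j k a b c} → Rearrangement i j k a b c →
  (pi : P i) (pj : P j) (pk : P k) (pa : P a) (pb : P b) (pc : P c) →
  Rearrangement {Σ A P} (i , pi) (j , pj) (k , pk) (a , pa) (b , pb) (c , pc)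
Rearrangement-with-proofs irr ijk pi pj pk pa pb pc
  rewrite irr pa pi | irr pb pj | irr pc pk = ijk
Rearrangement-with-proofs irr ikj pi pj pk pa pb pc
  rewrite irr pa pi | irr pb pk | irr pc pj = ikj
Rearrangement-with-proofs irr jik pi pj pk pa pb pc
  rewrite irr pa pj | irr pb pi | irr pc pk = jik
Rearrangement-with-proofs irr jki pi pj pk pa pb pc
  rewrite irr pa pj | irr pb pk | irr pc pi = jki
Rearrangement-with-proofs irr kij pi pj pk pa pb pc
  rewrite irr pa pk | irr pb pi | irr pc pj = kij
Rearrangement-with-proofs irr kji pi pj pk pa pb pc
  rewrite irr pa pk | irr pb pj | irr pc pi = kji

lemma3p7 : (n : ℕ) → 2 ≤ n →
    (i j k : ℕ) → (1i : 1 ≤ i) → (in' : i < n) → (1j : 1 ≤ j) → (jn : j < n) →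
    (1k : 1 ≤ k) → (kn : k < n) →
    (a b c : ℕ) → (an : a < n) → (bn : b < n) → (cn : c < n) →
    Rearrangement i j k a b c →
    (ord : ℕ) →
    IsOrder (prefixRev n a an ∘ prefixRev n b bn ∘ prefixRev n c cn) ord
      ⇔ IsOrder (prefixRev n i in' ∘ prefixRev n j jn ∘ prefixRev n k kn) ord
lemma3p7 n _ i j k _ in' _ jn _ kn a b c an bn cn R =
  IsOrder-cong (rearrangement-SameIdentityPowers f (λ (x , x<n) → prefixRev-involutive x<n)
    (Rearrangement-with-proofs <-irrelevant R in' jn kn an bn cn))
  where
  f : Σ ℕ (_< n) → Fin n → Fin n
  f (x , x<n) = prefixRev n x x<n
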